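{- Let $p$ be a prime, $q=p^{r}$, $k\geq 3$ with $k\mid(q-1)$, $F=\mathrm{GF}(q)$, and $\Phi$ the unique multiplicative subgroup of $F^{*}$ of order $k$. Suppose $\Phi$ contains the multiplicative group $K^{*}$ of some subfield $K$ of $F$. If $(F,\Phi)$ is circular, then $|K|\leq 4$.
   Context: The pair $(F,\Phi)$ is circular if $|\Phi a\cap(\Phi b+c)|\leq 2$ for all $a,b,c\in F^{*}$. -}

module Defs where

open import Level using (0ℓ)
open import Data.Nat using (ℕ; suc)
open import Data.Fin using (Fin)
open import Data.Bool using (Bool; true)
open import Data.Product using (Σ; ∃; _×_)
open import Relation.Nullary using (¬_)
open import Relation.Binary.PropositionalEquality using (_≡_; _≢_)
open import Algebra.Structures using (IsCommutativeRing)
open import Function.Bundles using (_↔_)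
open import Function.Definitions using (Injective)

-- A field, with propositional equality on the carrier.  The inverse is a
-- total operation; only its behaviour on nonzero elements is constrained.
record Field : Set₁ where
  infixl 7 _*_
  infixl 6 _+_
  field
    Carrier : Set
    _+_ _*_ : Carrier → Carrier → Carrier
    -_ : Carrier → Carrier
    0# 1# : Carrier
    _⁻¹ : Carrier → Carrier
    isCommutativeRing : IsCommutativeRing _≡_ _+_ _*_ -_ 0# 1#
    0≢1 : 0# ≢ 1#
    inverseʳ : ∀ x → x ≢ 0# → x * (x ⁻¹) ≡ 1#

-- Subsets of a type are Bool-valued predicates (so membership proofs are unique).
Subset : Set → Set
Subset A = A → Bool

_∈_ : {A : Set} → A → Subset A → Set
x ∈ S = S x ≡ true

HasSize : {A : Set} → Subset A → ℕ → Set
HasSize {A} S n = Σ A (λ x → x ∈ S) ↔ Fin n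

AtMost : {A : Set} → ℕ → (A → Set) → Set
AtMost {A} n P = (f : Fin (suc n) → A) → (∀ i → P (f i)) → ¬ Injective _≡_ _≡_ f

module _ (F : Field) where
  open Field F

  HasOrder : ℕ → Set
  HasOrder q = Carrier ↔ Fin q

  IsSubgroupOfUnits : Subset Carrier → Set
  IsSubgroupOfUnits Φ =
    (∀ x → x ∈ Φ → x ≢ 0#) × (1# ∈ Φ) ×
    (∀ x y → x ∈ Φ → y ∈ Φ → (x * y) ∈ Φ) × (∀ x → x ∈ Φ → (x ⁻¹) ∈ Φ)

  IsSubfield : Subset Carrier → Set
  IsSubfield K =
    (0# ∈ K) × (1# ∈ K) ×
    (∀ x y → x ∈ K → y ∈ K → (x + y) ∈ K) ×
    (∀ x → x ∈ K → (- x) ∈ K) ×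
    (∀ x y → x ∈ K → y ∈ K → (x * y) ∈ K) ×
    (∀ x → x ∈ K → x ≢ 0# → (x ⁻¹) ∈ K)

  InCoset : Subset Carrier → Carrier → Carrier → Set
  InCoset Φ a x = ∃ λ φ → φ ∈ Φ × x ≡ φ * a

  -- (F, Φ) is circular: |Φa ∩ (Φb + c)| ≤ 2 for all a, b, c ∈ F*.
  Circular : Subset Carrier → Set
  Circular Φ = ∀ a b c → a ≢ 0# → b ≢ 0# → c ≢ 0# →
    AtMost 2 (λ x → InCoset Φ a x × (∃ λ y → InCoset Φ b y × x ≡ y + c))

-- Every x ∈ K other than 0 and 1 lies in Φ ∩ (Φ + 1), because x and x − 1 are
-- both in K* ⊆ Φ and x = (x − 1) + 1.  Circularity with a = b = c = 1 allows at
-- most two such points, so K has at most 2 + 2 = 4 elements.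
module Submission where

open import Defs
open import Data.Bool using (true; false)
import Data.Bool.Properties as Bool
open import Data.Empty using (⊥-elim)
open import Data.Fin using (Fin; zero; suc)
import Data.Fin.Properties as Fin
open import Data.Nat using (ℕ; suc; _^_; _∸_; _≤_; s≤s; z≤n)
open import Data.Nat.Divisibility using (_∣_)
open import Data.Nat.Primality using (Prime)
open import Data.Product using (Σ; ∃; _×_; _,_; proj₁; proj₂; map₂)
open import Function using (_∘_)
open import Function.Bundles using (_↔_; Inverse; mk↔ₛ′)
open import Function.Definitions using (Injective)
open import Function.Properties.Inverse using (↔⇒↣)
open import Algebra.Structures using (IsCommutativeRing)
open import Axiom.UniquenessOfIdentityProofs using (module Decidable⇒UIP)
open import Relation.Binary.Definitions using (DecidableEquality)
open import Relation.Binary.PropositionalEquality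
open import Relation.Nullary using (¬_; Dec; yes; no)
open import Relation.Nullary.Decidable using (map′; via-injection)

AtMost-mono : {A : Set} {P Q : A → Set} {m : ℕ} →
  (∀ x → P x → Q x) → AtMost m Q → AtMost m P
AtMost-mono P⊆Q atMost f Pf = atMost f (λ i → P⊆Q (f i) (Pf i))

module DecidableSubsets {A : Set} (_≟_ : DecidableEquality A) where

  Σ-∈-≡ : ∀ {S : Subset A} {x y} {p : x ∈ S} {q : y ∈ S} →
    x ≡ y → _≡_ {A = Σ A (_∈ S)} (x , p) (y , q)
  Σ-∈-≡ refl = cong (_ ,_) (Decidable⇒UIP.≡-irrelevant Bool._≟_ _ _)

  remove : Subset A → A → Subset A
  remove S x y with y ≟ x
  ... | yes _ = false
  ... | no _ = S y

  ∈-remove⁺ : ∀ {S x y} → y ∈ S → y ≢ x → y ∈ remove S x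
  ∈-remove⁺ {x = x} {y} y∈S y≢x with y ≟ x
  ... | yes y≡x = ⊥-elim (y≢x y≡x)
  ... | no _ = y∈S

  ∈-remove⁻ : ∀ {S x y} → y ∈ remove S x → y ∈ S × y ≢ x
  ∈-remove⁻ {x = x} {y} y∈S∖x with y ≟ x
  ... | no y≢x = y∈S∖x , y≢x

  HasSize-empty : ∀ {S : Subset A} → ¬ (∃ λ x → x ∈ S) → HasSize S 0
  HasSize-empty ∄x = mk↔ₛ′ (⊥-elim ∘ ∄x) (λ ()) (λ ()) (⊥-elim ∘ ∄x)

  HasSize-insert : ∀ {S x n} → x ∈ S → HasSize (remove S x) n → HasSize S (suc n)
  HasSize-insert {S} {x} {n} x∈S size = mk↔ₛ′ to from to∘from from∘to
    where
    open Inverse size renaming (to to to∖; from to from∖)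

    to-by : ∀ {y} → y ∈ S → Dec (y ≡ x) → Fin (suc n)
    to-by _ (yes _) = zero
    to-by y∈S (no y≢x) = suc (to∖ (_ , ∈-remove⁺ y∈S y≢x))

    to : Σ A (_∈ S) → Fin (suc n)
    to (y , y∈S) = to-by y∈S (y ≟ x)

    from : Fin (suc n) → Σ A (_∈ S)
    from zero = x , x∈S
    from (suc i) = map₂ (proj₁ ∘ ∈-remove⁻) (from∖ i)

    to-∉ : ∀ {y} {y∈S : y ∈ S} (y∈S∖x : y ∈ remove S x) → to (y , y∈S) ≡ suc (to∖ (y , y∈S∖x))
    to-∉ {y} y∈S∖x = to-by-∉ (y ≟ x)
      where
      to-by-∉ : ∀ {y∈S} (y≟x : Dec (y ≡ x)) → to-by y∈S y≟x ≡ suc (to∖ (y , y∈S∖x))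
      to-by-∉ (yes y≡x) = ⊥-elim (proj₂ (∈-remove⁻ y∈S∖x) y≡x)
      to-by-∉ (no _) = cong (suc ∘ to∖) (Σ-∈-≡ refl)

    to∘from : ∀ i → to (from i) ≡ i
    to∘from zero with x ≟ x
    ... | yes _ = refl
    ... | no x≢x = ⊥-elim (x≢x refl)
    to∘from (suc i) = trans (to-∉ (proj₂ (from∖ i))) (cong suc (strictlyInverseˡ i))

    from∘to : ∀ y → from (to y) ≡ y
    from∘to (y , y∈S) with y ≟ x
    ... | yes y≡x = Σ-∈-≡ (sym y≡x)
    ... | no y≢x = Σ-∈-≡ (cong proj₁ (strictlyInverseʳ (y , ∈-remove⁺ y∈S y≢x)))

  AtMost-remove : ∀ {S x m} → x ∈ S → AtMost (suc m) (_∈ S) → AtMost m (_∈ remove S x)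
  AtMost-remove {S} {x} {m} x∈S atMost f f∈S∖x f-injective =
    atMost g g∈S g-injective
    where
    g : Fin (suc (suc m)) → A
    g zero = x
    g (suc i) = f i

    g∈S : ∀ i → g i ∈ S
    g∈S zero = x∈S
    g∈S (suc i) = proj₁ (∈-remove⁻ (f∈S∖x i))

    g-injective : Injective _≡_ _≡_ g
    g-injective {zero} {zero} _ = refl
    g-injective {zero} {suc j} x≡fj = ⊥-elim (proj₂ (∈-remove⁻ (f∈S∖x j)) (sym x≡fj))
    g-injective {suc i} {zero} fi≡x = ⊥-elim (proj₂ (∈-remove⁻ (f∈S∖x i)) fi≡x)
    g-injective {suc i} {suc j} fi≡fj = cong suc (f-injective fi≡fj)

module FiniteSubsets {A : Set} {q : ℕ} (enumeration : A ↔ Fin q) where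

  _≟_ : DecidableEquality A
  _≟_ = via-injection (↔⇒↣ enumeration) Fin._≟_

  open DecidableSubsets _≟_ public
  open Inverse enumeration

  any∈? : (S : Subset A) → Dec (∃ λ x → x ∈ S)
  any∈? S = map′ (λ (i , p) → from i , p)
                 (λ (x , p) → to x , subst (_∈ S) (sym (strictlyInverseʳ x)) p)
                 (Fin.any? (λ i → S (from i) Bool.≟ true))

  HasSize-≤ : ∀ m S → AtMost m (_∈ S) → ∃ λ n → HasSize S n × n ≤ m
  HasSize-≤ m S atMost with any∈? S
  HasSize-≤ m S atMost | no ∄x = 0 , HasSize-empty ∄x , z≤n
  HasSize-≤ 0 S atMost | yes (x , x∈S) =
    ⊥-elim (atMost (λ _ → x) (λ _ → x∈S) λ { {zero} {zero} _ → refl })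
  HasSize-≤ (suc m) S atMost | yes (x , x∈S) =
    let n , size , n≤m = HasSize-≤ m (remove S x) (AtMost-remove x∈S atMost)
    in suc n , HasSize-insert x∈S size , s≤s n≤m

module _ (F : Field) where
  open Field F
  open IsCommutativeRing isCommutativeRing
    using (+-assoc; -‿inverseˡ; +-identityˡ; +-identityʳ; *-identityʳ)

  InΦ∩[Φ+1] : Subset Carrier → Carrier → Set
  InΦ∩[Φ+1] Φ x = InCoset F Φ 1# x × (∃ λ y → InCoset F Φ 1# y × x ≡ y + 1#)

  ∈⇒InCoset1 : ∀ {Φ x} → x ∈ Φ → InCoset F Φ 1# x
  ∈⇒InCoset1 {x = x} x∈Φ = x , x∈Φ , sym (*-identityʳ x)

  x-1+1≡x : ∀ x → (x + - 1#) + 1# ≡ x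
  x-1+1≡x x = begin
    (x + - 1#) + 1#  ≡⟨ +-assoc x (- 1#) 1# ⟩
    x + (- 1# + 1#)  ≡⟨ cong (x +_) (-‿inverseˡ 1#) ⟩
    x + 0#           ≡⟨ +-identityʳ x ⟩
    x                ∎
    where open ≡-Reasoning

  subfield∖01⊆Φ∩[Φ+1] : ∀ {Φ K} → IsSubfield F K → (∀ x → x ∈ K → x ≢ 0# → x ∈ Φ) →
    ∀ x → x ∈ K → x ≢ 0# → x ≢ 1# → InΦ∩[Φ+1] Φ x
  subfield∖01⊆Φ∩[Φ+1] {K = K} (_ , 1∈K , +-closed , neg-closed , _) K*⊆Φ x x∈K x≢0 x≢1 =
    ∈⇒InCoset1 (K*⊆Φ x x∈K x≢0) ,
    x-1 , ∈⇒InCoset1 (K*⊆Φ x-1 x-1∈K x-1≢0) , sym (x-1+1≡x x)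
    where
    x-1 : Carrier
    x-1 = x + - 1#

    x-1∈K : x-1 ∈ K
    x-1∈K = +-closed x (- 1#) x∈K (neg-closed 1# 1∈K)

    x-1≢0 : x-1 ≢ 0#
    x-1≢0 x-1≡0 = x≢1 (begin
      x                ≡⟨ sym (x-1+1≡x x) ⟩
      x-1 + 1#         ≡⟨ cong (_+ 1#) x-1≡0 ⟩
      0# + 1#          ≡⟨ +-identityˡ 1# ⟩
      1#               ∎)
      where open ≡-Reasoning

lemma10 : (p r q k : ℕ) → Prime p → q ≡ p ^ r → 3 ≤ k → k ∣ (q ∸ 1) →
    (F : Field) → HasOrder F q →
    (Φ : Subset (Field.Carrier F)) → IsSubgroupOfUnits F Φ → HasSize Φ k →
    (K : Subset (Field.Carrier F)) → IsSubfield F K →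
    (∀ x → x ∈ K → x ≢ Field.0# F → x ∈ Φ) →
    Circular F Φ →
    ∃ λ n → HasSize K n × n ≤ 4
lemma10 _ _ _ _ _ _ _ _ F order Φ _ _ K subfield K*⊆Φ circular =
  let n , K∖01-size , n≤2 = HasSize-≤ 2 K∖01 (AtMost-mono K∖01⊆Φ∩[Φ+1] Φ∩[Φ+1]-small)
  in suc (suc n) , HasSize-insert 0∈K (HasSize-insert (∈-remove⁺ 1∈K 1≢0) K∖01-size)
                 , s≤s (s≤s n≤2)
  where
  open Field F
  open FiniteSubsets order

  0∈K : 0# ∈ K
  0∈K = proj₁ subfield

  1∈K : 1# ∈ K
  1∈K = proj₁ (proj₂ subfield)

  1≢0 : 1# ≢ 0#
  1≢0 = 0≢1 ∘ sym

  K∖01 : Subset Carrier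
  K∖01 = remove (remove K 0#) 1#

  K∖01⊆Φ∩[Φ+1] : ∀ x → x ∈ K∖01 → InΦ∩[Φ+1] F Φ x
  K∖01⊆Φ∩[Φ+1] x x∈K∖01 =
    let x∈K∖0 , x≢1 = ∈-remove⁻ x∈K∖01
        x∈K , x≢0 = ∈-remove⁻ x∈K∖0
    in subfield∖01⊆Φ∩[Φ+1] F subfield K*⊆Φ x x∈K x≢0 x≢1

  Φ∩[Φ+1]-small : AtMost 2 (InΦ∩[Φ+1] F Φ)
  Φ∩[Φ+1]-small = circular 1# 1# 1# 1≢0 1≢0 1≢0
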